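{- Let $\Gamma,\Delta$ be finite sets of formulas in $For_1$, not both empty. If the sequent $\Gamma \Rightarrow \Delta$ is provable in the sequent calculus $\mathbf{H}$, then $\vDash_{\mathbf{H}_3} \Gamma \Rightarrow \Delta$. In particular, if $\Gamma \Rightarrow \alpha$ is provable in $\mathbf{H}$ then $\Gamma \vDash_{\mathbf{H}_3} \alpha$.
   Context: Fix a denumerable set $prop$ of propositional variables. $For_1$ is the set of formulas built from $prop$ with a unary connective $\lnot$ and a binary connective $\vee$. For a formula $\alpha$, $var(\alpha)$ is the set of propositional variables occurring in $\alpha$, and $var(\Gamma)=\bigcup_{\gamma\in\Gamma}var(\gamma)$. A sequent $\Gamma\Rightarrow\Delta$ is an ordered pair of finite sets of formulas, not both empty; $\alpha,\Gamma$ and $\Gamma,\alpha$ denote $\Gamma\cup\{\alpha\}$. The calculus $\mathbf{H}$ has the axiom $\alpha\Rightarrow\alpha$ and the rules (premises / conclusion): (W$\Rightarrow$) $\Gamma\Rightarrow\Delta$ / $\alpha,\Gamma\Rightarrow\Delta$; ($\Rightarrow$W) $\Gamma\Rightarrow\Delta$ / $\Gamma\Rightarrow\Delta,\alpha$; (Cut) $\Gamma\Rightarrow\Delta,\alpha$ and $\alpha,\Gamma\Rightarrow\Delta$ / $\Gamma\Rightarrow\Delta$; ($\Rightarrow\lnot$) $\alpha,\Gamma\Rightarrow\Delta$ / $\Gamma\Rightarrow\Delta,\lnot\alpha$; ($\lnot^H\Rightarrow$) $\Gamma\Rightarrow\Delta,\alpha$ / $\lnot\alpha,\Gamma\Rightarrow\Delta$,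 allowed only if $var(\alpha)\subseteq var(\Delta)$; ($\vee\Rightarrow$) $\alpha_1,\Gamma\Rightarrow\Delta$ and $\alpha_2,\Gamma\Rightarrow\Delta$ / $\alpha_1\vee\alpha_2,\Gamma\Rightarrow\Delta$; ($\Rightarrow\vee$) $\Gamma\Rightarrow\Delta,\alpha_1,\alpha_2$ / $\Gamma\Rightarrow\Delta,\alpha_1\vee\alpha_2$. Halldén's logic $\mathbf{H}_3$ on $For_1$: truth values $\{1,\tfrac12,0\}$ with designated set $\{1,\tfrac12\}$; a valuation is a map $prop\to\{1,\tfrac12,0\}$ extended to formulas by $\lnot 1=0,\lnot\tfrac12=\tfrac12,\lnot 0=1$, and $x\vee y=\tfrac12$ if $x=\tfrac12$ or $y=\tfrac12$, otherwise classical disjunction on $\{0,1\}$. A valuation $v$ is a model of $\Gamma\Rightarrow\Delta$ if whenever $v(\gamma)$ is designated for all $\gamma\in\Gamma$, $v(\delta)$ is designated for some $\delta\in\Delta$; $\vDash_{\mathbf{H}_3}\Gamma\Rightarrow\Delta$ means every valuation is a model of it. $\Gamma\vDash_{\mathbf{H}_3}\alpha$ means every valuation designating all members of $\Gamma$ designates $\alpha$. -}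

module Defs where

open import Data.Nat using (ℕ)
open import Data.List using (List; []; _∷_; _++_; concatMap)
open import Data.List.Membership.Propositional using (_∈_)
open import Data.Product using (_×_; ∃-syntax)
open import Relation.Nullary using (¬_)
open import Data.Unit using (⊤)
open import Data.Empty using (⊥)
open import Relation.Binary.PropositionalEquality using (_≡_)

data Formula : Set where
  var′ : ℕ → Formula
  ¬′_  : Formula → Formula
  _∨′_ : Formula → Formula → Formula

vars : Formula → List ℕ
vars (var′ p) = p ∷ []
vars (¬′ α) = vars α
vars (α ∨′ β) = vars α ++ vars β

varsL : List Formula → List ℕ
varsL = concatMap vars

-- Finite sets of formulas are represented by lists, read extensionally
-- (membership only); α , Γ is α ∷ Γ, and the rule `set-eq` below makes
-- derivability invariant under equality of the underlying sets.
_⊆_ : List Formula → List Formula → Set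
Γ ⊆ Γ′ = ∀ {α} → α ∈ Γ → α ∈ Γ′

NotBothEmpty : List Formula → List Formula → Set
NotBothEmpty Γ Δ = ¬ (Γ ≡ [] × Δ ≡ [])

infix 4 _⊢_
data _⊢_ : List Formula → List Formula → Set where
  ax    : ∀ α → (α ∷ []) ⊢ (α ∷ [])
  set-eq : ∀ {Γ Γ′ Δ Δ′} → Γ ⊆ Γ′ → Γ′ ⊆ Γ → Δ ⊆ Δ′ → Δ′ ⊆ Δ →
           Γ ⊢ Δ → Γ′ ⊢ Δ′
  W⇒    : ∀ {Γ Δ} α → Γ ⊢ Δ → (α ∷ Γ) ⊢ Δ
  ⇒W    : ∀ {Γ Δ} α → Γ ⊢ Δ → Γ ⊢ (α ∷ Δ)
  cut   : ∀ {Γ Δ} α → NotBothEmpty Γ Δ →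
          Γ ⊢ (α ∷ Δ) → (α ∷ Γ) ⊢ Δ → Γ ⊢ Δ
  ⇒¬    : ∀ {Γ Δ α} → (α ∷ Γ) ⊢ Δ → Γ ⊢ ((¬′ α) ∷ Δ)
  ¬H⇒   : ∀ {Γ Δ α} → (∀ {p} → p ∈ vars α → p ∈ varsL Δ) →
          Γ ⊢ (α ∷ Δ) → ((¬′ α) ∷ Γ) ⊢ Δ
  ∨⇒    : ∀ {Γ Δ α₁ α₂} → (α₁ ∷ Γ) ⊢ Δ → (α₂ ∷ Γ) ⊢ Δ →
          ((α₁ ∨′ α₂) ∷ Γ) ⊢ Δ
  ⇒∨    : ∀ {Γ Δ α₁ α₂} → Γ ⊢ (α₁ ∷ α₂ ∷ Δ) → Γ ⊢ ((α₁ ∨′ α₂) ∷ Δ)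

data V3 : Set where
  one half zero : V3

Designated : V3 → Set
Designated one  = ⊤
Designated half = ⊤
Designated zero = ⊥

neg3 : V3 → V3
neg3 one  = zero
neg3 half = half
neg3 zero = one

or3 : V3 → V3 → V3
or3 half _    = half
or3 one  half = half
or3 zero half = half
or3 one  one  = one
or3 one  zero = one
or3 zero one  = one
or3 zero zero = zero

Valuation : Set
Valuation = ℕ → V3

eval : Valuation → Formula → V3
eval v (var′ p) = v p
eval v (¬′ α) = neg3 (eval v α)
eval v (α ∨′ β) = or3 (eval v α) (eval v β)

IsModel : Valuation → List Formula → List Formula → Set
IsModel v Γ Δ = (∀ {γ} → γ ∈ Γ → Designated (eval v γ)) →
                ∃[ δ ] (δ ∈ Δ × Designated (eval v δ))

ValidH3 : List Formula → List Formula → Set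
ValidH3 Γ Δ = ∀ (v : Valuation) → IsModel v Γ Δ

_⊨H3_ : List Formula → Formula → Set
Γ ⊨H3 α = ∀ (v : Valuation) → (∀ {γ} → γ ∈ Γ → Designated (eval v γ)) →
          Designated (eval v α)

-- All rules except
-- (¬ᴴ⇒) are sound for any three-valued matrix whose negation and
-- disjunction behave classically on designated values; the facts needed
-- are collected first as truth-table lemmas about V3.
--
-- The restricted rule (¬ᴴ⇒) rests on the "infectiousness" of the value ½:
-- a formula takes the value ½ exactly when one of its variables does.
-- If α and ¬α are both designated then α = ½, so some variable of α is ½;
-- the side condition var(α) ⊆ var(Δ) places that variable in some δ ∈ Δ,
-- which is then ½ and hence designated.

module Submission where

open import Defs
open import Data.List using (List; []; _∷_)
open import Data.List.Relation.Unary.Any using (Any; here; there)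
open import Data.List.Relation.Unary.Any.Properties using (++⁺ˡ; ++⁺ʳ; ++⁻)
open import Data.List.Membership.Propositional using (_∈_; find; lose)
open import Data.List.Membership.Propositional.Properties using (∈-concatMap⁻)
open import Data.Product using (_×_; _,_; ∃-syntax)
open import Data.Sum using (_⊎_; inj₁; inj₂; [_,_]′)
open import Data.Nat using (ℕ)
open import Data.Unit using (tt)
open import Function using (id)
open import Relation.Binary.PropositionalEquality using (_≡_; refl; cong)

neg3-half⁻ : ∀ x → neg3 x ≡ half → x ≡ half
neg3-half⁻ half _ = refl

or3-half⁻ : ∀ x y → or3 x y ≡ half → x ≡ half ⊎ y ≡ half
or3-half⁻ half y    _ = inj₁ refl
or3-half⁻ one  half _ = inj₂ refl
or3-half⁻ zero half _ = inj₂ refl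

or3-half⁺ : ∀ x y → x ≡ half ⊎ y ≡ half → or3 x y ≡ half
or3-half⁺ half y    _        = refl
or3-half⁺ one  half _        = refl
or3-half⁺ zero half _        = refl
or3-half⁺ one  one  (inj₁ ())
or3-half⁺ one  one  (inj₂ ())
or3-half⁺ one  zero (inj₁ ())
or3-half⁺ one  zero (inj₂ ())
or3-half⁺ zero one  (inj₁ ())
or3-half⁺ zero one  (inj₂ ())
or3-half⁺ zero zero (inj₁ ())
or3-half⁺ zero zero (inj₂ ())

half-designated : ∀ {x} → x ≡ half → Designated x
half-designated refl = tt

designated-or-neg : ∀ x → Designated x ⊎ Designated (neg3 x)
designated-or-neg one  = inj₁ tt
designated-or-neg half = inj₁ tt
designated-or-neg zero = inj₂ tt

glut-is-half : ∀ x → Designated x → Designated (neg3 x) → x ≡ half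
glut-is-half half _ _ = refl

or3-designated⁻ : ∀ x y → Designated (or3 x y) → Designated x ⊎ Designated y
or3-designated⁻ one  y    _ = inj₁ tt
or3-designated⁻ half y    _ = inj₁ tt
or3-designated⁻ zero one  _ = inj₂ tt
or3-designated⁻ zero half _ = inj₂ tt

or3-designated⁺ : ∀ x y → Designated x ⊎ Designated y → Designated (or3 x y)
or3-designated⁺ one  one  _ = tt
or3-designated⁺ one  half _ = tt
or3-designated⁺ one  zero _ = tt
or3-designated⁺ half y    _ = tt
or3-designated⁺ zero one  _ = tt
or3-designated⁺ zero half _ = tt
or3-designated⁺ zero zero (inj₁ ())
or3-designated⁺ zero zero (inj₂ ())

module _ (v : Valuation) where

  AllDesignated : List Formula → Set
  AllDesignated Γ = ∀ {γ} → γ ∈ Γ → Designated (eval v γ)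

  SomeDesignated : List Formula → Set
  SomeDesignated Δ = ∃[ δ ] (δ ∈ Δ × Designated (eval v δ))

  IsHalf : ℕ → Set
  IsHalf p = v p ≡ half

  half-source : ∀ α → eval v α ≡ half → Any IsHalf (vars α)
  half-source (var′ p) e = here e
  half-source (¬′ α)   e = half-source α (neg3-half⁻ (eval v α) e)
  half-source (α ∨′ β) e with or3-half⁻ (eval v α) (eval v β) e
  ... | inj₁ eα = ++⁺ˡ (half-source α eα)
  ... | inj₂ eβ = ++⁺ʳ (vars α) (half-source β eβ)

  half-spreads : ∀ α → Any IsHalf (vars α) → eval v α ≡ half
  half-spreads (var′ p) (here e) = e
  half-spreads (¬′ α)   h = cong neg3 (half-spreads α h)
  half-spreads (α ∨′ β) h =
    or3-half⁺ (eval v α) (eval v β)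
      ([ (λ hα → inj₁ (half-spreads α hα)) , (λ hβ → inj₂ (half-spreads β hβ)) ]′
         (++⁻ (vars α) h))

  half-reaches : ∀ {α Δ} → (∀ {p} → p ∈ vars α → p ∈ varsL Δ) →
                 eval v α ≡ half → SomeDesignated Δ
  half-reaches {α} {Δ} sub e with find (half-source α e)
  ... | p , p∈α , p-half with find (∈-concatMap⁻ vars (sub p∈α))
  ...   | δ , δ∈Δ , p∈δ = δ , δ∈Δ , half-designated (half-spreads δ (lose p∈δ p-half))

  extend : ∀ {α Γ} → Designated (eval v α) → AllDesignated Γ → AllDesignated (α ∷ Γ)
  extend dα h (here refl) = dα
  extend dα h (there m)   = h m

  weaken : ∀ {α Δ} → SomeDesignated Δ → SomeDesignated (α ∷ Δ)
  weaken (δ , m , d) = δ , there m , d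

  uncons : ∀ {α Δ} → SomeDesignated (α ∷ Δ) → Designated (eval v α) ⊎ SomeDesignated Δ
  uncons (_ , here refl , d) = inj₁ d
  uncons (δ , there m , d)   = inj₂ (δ , m , d)

  sound : ∀ {Γ Δ} → Γ ⊢ Δ → IsModel v Γ Δ
  sound (ax α) h = α , here refl , h (here refl)
  sound (set-eq Γ⊆Γ′ _ Δ⊆Δ′ _ p) h with sound p (λ m → h (Γ⊆Γ′ m))
  ... | δ , m , d = δ , Δ⊆Δ′ m , d
  sound (W⇒ α p) h = sound p (λ m → h (there m))
  sound (⇒W α p) h = weaken (sound p h)
  sound (cut α _ p q) h =
    [ (λ dα → sound q (extend dα h)) , id ]′ (uncons (sound p h))
  sound (⇒¬ {α = α} p) h =
    [ (λ dα → weaken (sound p (extend dα h))) , (λ d¬α → ¬′ α , here refl , d¬α) ]′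
      (designated-or-neg (eval v α))
  sound (¬H⇒ {α = α} sub p) h =
    [ (λ dα → half-reaches {α} sub (glut-is-half (eval v α) dα (h (here refl)))) , id ]′
      (uncons (sound p (λ m → h (there m))))
  sound (∨⇒ {α₁ = α₁} {α₂} p q) h =
    [ (λ d₁ → sound p (extend d₁ (λ m → h (there m))))
    , (λ d₂ → sound q (extend d₂ (λ m → h (there m)))) ]′
      (or3-designated⁻ (eval v α₁) (eval v α₂) (h (here refl)))
  sound (⇒∨ {α₁ = α₁} {α₂} p) h with uncons (sound p h)
  ... | inj₁ d₁ = α₁ ∨′ α₂ , here refl , or3-designated⁺ (eval v α₁) (eval v α₂) (inj₁ d₁)
  ... | inj₂ s with uncons s
  ...   | inj₁ d₂ = α₁ ∨′ α₂ , here refl , or3-designated⁺ (eval v α₁) (eval v α₂) (inj₂ d₂)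
  ...   | inj₂ s′ = weaken s′

single-succedent : ∀ {v α} → SomeDesignated v (α ∷ []) → Designated (eval v α)
single-succedent (_ , here refl , d) = d

mainTheorem1 : (∀ (Γ Δ : List Formula) → NotBothEmpty Γ Δ → Γ ⊢ Δ → ValidH3 Γ Δ)
               × (∀ (Γ : List Formula) (α : Formula) → Γ ⊢ (α ∷ []) → Γ ⊨H3 α)
mainTheorem1 =
  (λ Γ Δ _ p v → sound v p) ,
  (λ Γ α p v h → single-succedent (sound v p h))
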